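{- Let \(w_1 \geq 0\) be an integer and let \(Q_{w_1} = \mathrm{conv}((0,0),(0,w_1),(w_1/2,w_1/2)) \subset \mathbb{R}^2\). The map sending a lattice point \((x_1,x_2) \in Q_{w_1}\cap\mathbb{Z}^2\) to the four-point multiset \(\{0,x_1,x_2,w_1\} \subset \mathbb{Z}\) induces a bijection from the lattice points of \(Q_{w_1}\) to the set of four-point multisets in \(\mathbb{Z}\) of width \(w_1\), up to affine unimodular equivalence. In particular, the number of such sets up to equivalence is \(\frac{w_1^2}{4}+w_1+1\) if \(w_1\) is even and \(\frac{w_1^2}{4}+w_1+\frac34\) if \(w_1\) is odd.
   Context: A four-point set in \(\mathbb{Z}^d\) is a multiset of four (not necessarily distinct) lattice points. Its width (and multi-width) is that of its convex hull; for a multiset in \(\mathbb{Z}\) the width is its maximum minus its minimum. Two such sets are affine unimodularly equivalent if one is mapped to the other by \(x \mapsto Ax+b\) with \(A \in \mathrm{GL}_d(\mathbb{Z})\), \(b \in \mathbb{Z}^d\) (in \(\mathbb{Z}\): \(x \mapsto \pm x + b\)). -}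

module Defs where

open import Data.Bool using (Bool; true; false)
open import Data.Nat as ℕ using (ℕ)
open import Data.Integer using (ℤ; +_; -_; _+_; _*_; _-_; _≤_; _⊔_; _⊓_)
open import Data.List using (List; []; _∷_; map)
open import Data.List.Relation.Binary.Permutation.Propositional using (_↭_)
open import Data.Product using (Σ; _×_; _,_)
open import Relation.Binary.PropositionalEquality using (_≡_)

-- A four-point multiset in ℤ, given by an (unordered-up-to-permutation) 4-tuple.
FourSet : Set
FourSet = ℤ × ℤ × ℤ × ℤ

toList : FourSet → List ℤ
toList (a , b , c , d) = a ∷ b ∷ c ∷ d ∷ []

SameMultiset : FourSet → FourSet → Set
SameMultiset S T = toList S ↭ toList T

width : FourSet → ℤ
width (a , b , c , d) = ((a ⊔ b) ⊔ (c ⊔ d)) - ((a ⊓ b) ⊓ (c ⊓ d))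

affine : Bool → ℤ → ℤ → ℤ
affine true  t x = x + t
affine false t x = (- x) + t

Equiv : FourSet → FourSet → Set
Equiv S T = Σ Bool λ s → Σ ℤ λ t → map (affine s t) (toList S) ↭ toList T

-- Lattice points of Q_w = conv((0,0),(0,w),(w/2,w/2)):
-- x1 ≥ 0, x1 ≤ x2, x1 + x2 ≤ w.
InQ : ℕ → ℤ → ℤ → Set
InQ w x₁ x₂ = (+ 0 ≤ x₁) × (x₁ ≤ x₂) × (x₁ + x₂ ≤ + w)

φ : ℕ → ℤ → ℤ → FourSet
φ w x₁ x₂ = (+ 0 , x₁ , x₂ , + w)

-- Sort a four-point multiset of width w as a ≤ b ≤ c ≤ d, so d − a = w. The affine
-- unimodular maps that keep the minimum at 0 and the maximum at w are the identity and
-- the reflection x ↦ w − x, and a sorted list is determined by its multiset. Fixing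
-- the minimum gives the point (b − a, c − a), fixing the maximum gives (d − c, d − b);
-- the two coordinate sums add up to 2w, so one of them lies in Q_w, and both do only
-- when they coincide on the edge x₁ + x₂ = w. Hence every class has exactly one
-- representative φ(x₁, x₂) with (x₁, x₂) ∈ Q_w. For the count, the lattice points of
-- Q_{w+2} are the column x₁ = 0 together with those of Q_w shifted by (1, 1).

module Submission where

module FourPointSets where
  open import Defs
  open import Data.Bool using (true; false)
  open import Data.Integer using (ℤ; +_; -_; _+_; _-_; _≤_; _⊔_; _⊓_; _≤?_)
  open import Data.Integer.Properties
  open import Data.Integer.Tactic.RingSolver using (solve-∀)
  open import Data.List using (List; []; _∷_; map; reverse; length)
  open import Data.List.Membership.Propositional using (_∈_)
  open import Data.List.Relation.Binary.Permutation.Propositional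
    using (_↭_; ↭-refl; ↭-sym; ↭-trans; ↭-reflexive; ↭⇒↭ₛ)
  open import Data.List.Relation.Binary.Permutation.Propositional.Properties
    using (∈-resp-↭; All-resp-↭; ↭-length; ↭-reverse; map⁺)
  open import Data.List.Relation.Binary.Pointwise using (Pointwise-≡⇒≡)
  open import Data.List.Relation.Unary.All as All using (All; []; _∷_)
  open import Data.List.Relation.Unary.Any using (here; there)
  open import Data.List.Relation.Unary.Linked using ([-]; _∷_)
  open import Data.List.Relation.Unary.Sorted.TotalOrder ≤-totalOrder using (Sorted)
  open import Data.List.Relation.Unary.Sorted.TotalOrder.Properties using (↗↭↗⇒≋)
  open import Data.List.Sort ≤-decTotalOrder using (sort; sort-↭; sort-↗)
  open import Data.Product using (Σ; _×_; _,_)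
  open import Relation.Nullary using (yes; no; contradiction)
  open import Relation.Binary.PropositionalEquality

  ↭-sorted⇒≡ : ∀ {xs ys} → Sorted xs → Sorted ys → xs ↭ ys → xs ≡ ys
  ↭-sorted⇒≡ xs↗ ys↗ p = Pointwise-≡⇒≡ (↗↭↗⇒≋ ≤-totalOrder xs↗ ys↗ (↭⇒↭ₛ p))

  Sorted₄ : FourSet → Set
  Sorted₄ S = Sorted (toList S)

  fromList₄ : (xs : List ℤ) → length xs ≡ 4 → Σ FourSet λ T → toList T ≡ xs
  fromList₄ (a ∷ b ∷ c ∷ d ∷ []) refl = (a , b , c , d) , refl
  fromList₄ [] ()
  fromList₄ (_ ∷ []) ()
  fromList₄ (_ ∷ _ ∷ []) ()
  fromList₄ (_ ∷ _ ∷ _ ∷ []) ()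
  fromList₄ (_ ∷ _ ∷ _ ∷ _ ∷ _ ∷ _) ()

  sort₄ : (S : FourSet) → Σ FourSet λ T → Sorted₄ T × toList S ↭ toList T
  sort₄ S with fromList₄ (sort (toList S)) (↭-length (sort-↭ (toList S)))
  ... | T , T≡sorted = T , subst Sorted (sym T≡sorted) (sort-↗ (toList S))
                         , ↭-trans (↭-sym (sort-↭ (toList S))) (↭-reflexive (sym T≡sorted))

  max₄ min₄ : FourSet → ℤ
  max₄ (a , b , c , d) = (a ⊔ b) ⊔ (c ⊔ d)
  min₄ (a , b , c , d) = (a ⊓ b) ⊓ (c ⊓ d)

  ≤max₄ : ∀ S → All (_≤ max₄ S) (toList S)
  ≤max₄ (a , b , c , d) =
      i≤j⇒i≤j⊔k (c ⊔ d) (i≤i⊔j a b) ∷ i≤j⇒i≤j⊔k (c ⊔ d) (i≤j⊔i a b)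
    ∷ i≤j⇒i≤k⊔j (a ⊔ b) (i≤i⊔j c d) ∷ i≤j⇒i≤k⊔j (a ⊔ b) (i≤j⊔i c d) ∷ []

  max₄-least : ∀ S {m} → All (_≤ m) (toList S) → max₄ S ≤ m
  max₄-least (a , b , c , d) (a≤ ∷ b≤ ∷ c≤ ∷ d≤ ∷ []) = ⊔-lub (⊔-lub a≤ b≤) (⊔-lub c≤ d≤)

  min₄≤ : ∀ S → All (min₄ S ≤_) (toList S)
  min₄≤ (a , b , c , d) =
      i≤j⇒i⊓k≤j (c ⊓ d) (i⊓j≤i a b) ∷ i≤j⇒i⊓k≤j (c ⊓ d) (i⊓j≤j a b)
    ∷ i≤j⇒k⊓i≤j (a ⊓ b) (i⊓j≤i c d) ∷ i≤j⇒k⊓i≤j (a ⊓ b) (i⊓j≤j c d) ∷ []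

  min₄-greatest : ∀ S {n} → All (n ≤_) (toList S) → n ≤ min₄ S
  min₄-greatest (a , b , c , d) (≤a ∷ ≤b ∷ ≤c ∷ ≤d ∷ []) = ⊓-glb (⊓-glb ≤a ≤b) (⊓-glb ≤c ≤d)

  width-bounds : ∀ S {m n} → m ∈ toList S → All (_≤ m) (toList S) →
                 n ∈ toList S → All (n ≤_) (toList S) → width S ≡ m - n
  width-bounds S@(_ , _ , _ , _) m∈S ≤m n∈S n≤ = cong₂ _-_ max≡m min≡n
    where
    max≡m = ≤-antisym (max₄-least S ≤m) (All.lookup (≤max₄ S) m∈S)
    min≡n = ≤-antisym (All.lookup (min₄≤ S) n∈S) (min₄-greatest S n≤)

  width-↭-sorted : ∀ {S a b c d} → Sorted₄ (a , b , c , d) →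
                   toList S ↭ toList (a , b , c , d) → width S ≡ d - a
  width-↭-sorted {S} (a≤b ∷ b≤c ∷ c≤d ∷ [-]) p =
    width-bounds S (∈-resp-↭ (↭-sym p) (there (there (there (here refl)))))
                   (All-resp-↭ (↭-sym p) (a≤d ∷ b≤d ∷ c≤d ∷ ≤-refl ∷ []))
                   (∈-resp-↭ (↭-sym p) (here refl))
                   (All-resp-↭ (↭-sym p) (≤-refl ∷ a≤b ∷ ≤-trans a≤b b≤c ∷ a≤d ∷ []))
    where
    b≤d = ≤-trans b≤c c≤d
    a≤d = ≤-trans a≤b b≤d

  translate-sorted : ∀ {a b c d} t → Sorted₄ (a , b , c , d) →
                     Sorted₄ (a + t , b + t , c + t , d + t)
  translate-sorted t (a≤b ∷ b≤c ∷ c≤d ∷ [-]) =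
    +-monoˡ-≤ t a≤b ∷ +-monoˡ-≤ t b≤c ∷ +-monoˡ-≤ t c≤d ∷ [-]

  reflect-sorted : ∀ {a b c d} t → Sorted₄ (a , b , c , d) →
                   Sorted₄ (- d + t , - c + t , - b + t , - a + t)
  reflect-sorted t (a≤b ∷ b≤c ∷ c≤d ∷ [-]) =
      +-monoˡ-≤ t (neg-mono-≤ c≤d) ∷ +-monoˡ-≤ t (neg-mono-≤ b≤c)
    ∷ +-monoˡ-≤ t (neg-mono-≤ a≤b) ∷ [-]

  x₂≤w : ∀ {w x₁ x₂} → InQ w x₁ x₂ → x₂ ≤ + w
  x₂≤w {x₂ = x₂} (0≤x₁ , _ , x₁+x₂≤w) =
    ≤-trans (≤-reflexive (sym (+-identityˡ x₂))) (≤-trans (+-monoˡ-≤ x₂ 0≤x₁) x₁+x₂≤w)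

  φ-sorted : ∀ {w x₁ x₂} → InQ w x₁ x₂ → Sorted₄ (φ w x₁ x₂)
  φ-sorted q@(0≤x₁ , x₁≤x₂ , _) = 0≤x₁ ∷ x₁≤x₂ ∷ x₂≤w q ∷ [-]

  width-φ : ∀ {w x₁ x₂} → InQ w x₁ x₂ → width (φ w x₁ x₂) ≡ + w
  width-φ {w} q = trans (width-↭-sorted (φ-sorted q) ↭-refl) (+-identityʳ (+ w))

  toList-injective : ∀ {a b c d a′ b′ c′ d′} →
                     toList (a , b , c , d) ≡ toList (a′ , b′ , c′ , d′) →
                     a ≡ a′ × b ≡ b′ × c ≡ c′ × d ≡ d′
  toList-injective refl = refl , refl , refl , refl

  toList-cong : ∀ {a b c d a′ b′ c′ d′} → a ≡ a′ → b ≡ b′ → c ≡ c′ → d ≡ d′ →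
                toList (a , b , c , d) ≡ toList (a′ , b′ , c′ , d′)
  toList-cong refl refl refl refl = refl

  +-compensate-≤ : ∀ {u v p q} → u + v ≡ p + q → q ≤ v → u ≤ p
  +-compensate-≤ {u} {p = p} u+v≡p+q q≤v with u ≤? p
  ... | yes u≤p = u≤p
  ... | no u≰p = contradiction (+-mono-<-≤ (≰⇒> u≰p) q≤v) (<-irrefl (sym u+v≡p+q))

  reflection-in-Q : ∀ {w x₁ x₂ y₁ y₂} → InQ w x₁ x₂ → InQ w y₁ y₂ →
                    - x₂ + + w ≡ y₁ → - x₁ + + w ≡ y₂ → x₁ ≡ y₁ × x₂ ≡ y₂
  reflection-in-Q {w} {x₁} {x₂} (_ , _ , x₁+x₂≤w) (_ , _ , y₁+y₂≤w) refl refl =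
    sym (trans (cong (_+_ (- x₂)) (sym x₁+x₂≡w)) (cancel₂ x₁ x₂)) ,
    sym (trans (cong (_+_ (- x₁)) (sym x₁+x₂≡w)) (cancel₁ x₁ x₂))
    where
    sums : ∀ x₁ x₂ w → w + w ≡ (x₁ + x₂) + ((- x₂ + w) + (- x₁ + w))
    sums = solve-∀
    cancel₁ : ∀ x₁ x₂ → - x₁ + (x₁ + x₂) ≡ x₂
    cancel₁ = solve-∀
    cancel₂ : ∀ x₁ x₂ → - x₂ + (x₁ + x₂) ≡ x₁
    cancel₂ = solve-∀
    x₁+x₂≡w : x₁ + x₂ ≡ + w
    x₁+x₂≡w = ≤-antisym x₁+x₂≤w (+-compensate-≤ (sums x₁ x₂ (+ w)) y₁+y₂≤w)

  translation-injective : ∀ {w x₁ x₂ y₁ y₂} t → InQ w x₁ x₂ → InQ w y₁ y₂ →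
    map (affine true t) (toList (φ w x₁ x₂)) ↭ toList (φ w y₁ y₂) → x₁ ≡ y₁ × x₂ ≡ y₂
  translation-injective {x₁ = x₁} {x₂} t qx qy p
    with 0+t≡0 , x₁+t≡y₁ , x₂+t≡y₂ , _ ←
           toList-injective (↭-sorted⇒≡ (translate-sorted t (φ-sorted qx)) (φ-sorted qy) p)
    with refl ← trans (sym (+-identityˡ t)) 0+t≡0
    = trans (sym (+-identityʳ x₁)) x₁+t≡y₁ , trans (sym (+-identityʳ x₂)) x₂+t≡y₂

  reflection-injective : ∀ {w x₁ x₂ y₁ y₂} t → InQ w x₁ x₂ → InQ w y₁ y₂ →
    map (affine false t) (toList (φ w x₁ x₂)) ↭ toList (φ w y₁ y₂) → x₁ ≡ y₁ × x₂ ≡ y₂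
  reflection-injective {w} {x₁} {x₂} {y₁} {y₂} t qx qy p = conclude (toList-injective image≡)
    where
    image : List ℤ
    image = map (affine false t) (toList (φ w x₁ x₂))
    image≡ : reverse image ≡ toList (φ w y₁ y₂)
    image≡ = ↭-sorted⇒≡ (reflect-sorted t (φ-sorted qx)) (φ-sorted qy)
                        (↭-trans (↭-reverse image) p)
    conclude : - + w + t ≡ + 0 × - x₂ + t ≡ y₁ × - x₁ + t ≡ y₂ × + 0 + t ≡ + w →
               x₁ ≡ y₁ × x₂ ≡ y₂
    conclude (_ , -x₂+t≡y₁ , -x₁+t≡y₂ , 0+t≡w) =
      reflection-in-Q qx qy (trans (cong (_+_ (- x₂)) (sym t≡w)) -x₂+t≡y₁)
                            (trans (cong (_+_ (- x₁)) (sym t≡w)) -x₁+t≡y₂)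
      where
      t≡w : t ≡ + w
      t≡w = trans (sym (+-identityˡ t)) 0+t≡w

  φ-injective : ∀ {w x₁ x₂ y₁ y₂} → InQ w x₁ x₂ → InQ w y₁ y₂ →
                Equiv (φ w x₁ x₂) (φ w y₁ y₂) → x₁ ≡ y₁ × x₂ ≡ y₂
  φ-injective qx qy (true  , t , p) = translation-injective t qx qy p
  φ-injective qx qy (false , t , p) = reflection-injective t qx qy p

  Equiv-resp-↭ : ∀ {S T U} → toList S ↭ toList T → Equiv T U → Equiv S U
  Equiv-resp-↭ S↭T (s , t , p) = s , t , ↭-trans (map⁺ (affine s t) S↭T) p

  sorted-normal-form : ∀ {w a b c d} → Sorted₄ (a , b , c , d) → d - a ≡ + w →
    Σ ℤ λ x₁ → Σ ℤ λ x₂ → InQ w x₁ x₂ × Equiv (a , b , c , d) (φ w x₁ x₂)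
  sorted-normal-form {w} {a} {b} {c} {d} (a≤b ∷ b≤c ∷ c≤d ∷ [-]) d-a≡w
    with (b - a) + (c - a) ≤? + w
  ... | yes Σ≤w = b - a , c - a , (i≤j⇒0≤j-i a≤b , +-monoˡ-≤ (- a) b≤c , Σ≤w) ,
                  true , - a , ↭-reflexive translated
    where
    translated : map (affine true (- a)) (toList (a , b , c , d)) ≡
                 toList (φ w (b - a) (c - a))
    translated = toList-cong (+-inverseʳ a) refl refl d-a≡w
  ... | no Σ≰w = d - c , d - b , (i≤j⇒0≤j-i c≤d , +-monoʳ-≤ d (neg-mono-≤ b≤c) , Σ′≤w) ,
                 false , d , ↭-trans (↭-sym (↭-reverse reflected)) (↭-reflexive reflected≡)
    where
    reflected : List ℤ
    reflected = map (affine false d) (toList (a , b , c , d))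
    reflected≡ : reverse reflected ≡ toList (φ w (d - c) (d - b))
    reflected≡ = toList-cong (+-inverseˡ d) (+-comm (- c) d) (+-comm (- b) d)
                             (trans (+-comm (- a) d) d-a≡w)
    sums : ∀ a b c d → ((d - c) + (d - b)) + ((b - a) + (c - a)) ≡ (d - a) + (d - a)
    sums = solve-∀
    Σ′≤w : (d - c) + (d - b) ≤ + w
    Σ′≤w = +-compensate-≤ (trans (sums a b c d) (cong₂ _+_ d-a≡w d-a≡w)) (<⇒≤ (≰⇒> Σ≰w))

  φ-surjective : ∀ {w} S → width S ≡ + w →
    Σ ℤ λ x₁ → Σ ℤ λ x₂ → InQ w x₁ x₂ × Equiv S (φ w x₁ x₂)
  φ-surjective S width≡w
    with (a , b , c , d) , T↗ , S↭T ← sort₄ S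
    with x₁ , x₂ , q , T≃φ ←
           sorted-normal-form T↗ (trans (sym (width-↭-sorted T↗ S↭T)) width≡w)
    = x₁ , x₂ , q , Equiv-resp-↭ S↭T T≃φ

module LatticePoints where
  open import Data.Nat
  open import Data.Nat.Properties
  open import Data.Nat.Divisibility using (_∣_; divides; ∣m+n∣m⇒∣n; ∣m∣n⇒∣m+n; n∣n)
  open import Data.Nat.Tactic.RingSolver using (solve-∀)
  open import Data.List using (List; map; upTo; _++_; length)
  open import Data.List.Properties using (length-++; length-map; length-upTo)
  open import Data.List.Membership.Propositional using (_∈_)
  open import Data.List.Membership.Propositional.Properties
    using (∈-map⁺; ∈-map⁻; ∈-++⁺ˡ; ∈-++⁺ʳ; ∈-upTo⁺; ∈-upTo⁻)
  open import Data.List.Relation.Unary.All as All using (All)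
  import Data.List.Relation.Unary.All.Properties as All
  open import Data.List.Relation.Unary.Unique.Propositional using (Unique)
  import Data.List.Relation.Unary.Unique.Propositional.Properties as Unique
  open import Data.Product using (_×_; _,_; proj₂)
  open import Relation.Nullary using (¬_; contradiction)
  open import Relation.Binary.PropositionalEquality

  Point : Set
  Point = ℕ × ℕ

  InQℕ : ℕ → Point → Set
  InQℕ w (a , b) = a ≤ b × a + b ≤ w

  onAxis : ℕ → Point
  onAxis b = 0 , b

  column : ℕ → List Point
  column n = map onAxis (upTo (suc n))

  shift : Point → Point
  shift (a , b) = suc a , suc b

  latticePoints : ℕ → List Point
  latticePoints zero = column 0
  latticePoints (suc zero) = column 1
  latticePoints (suc (suc w)) = column (suc (suc w)) ++ map shift (latticePoints w)

  column-sound : ∀ n → All (InQℕ n) (column n)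
  column-sound n = All.map⁺ (All.tabulate λ k∈ → z≤n , ≤-pred (∈-upTo⁻ k∈))

  shift-sound : ∀ w {p} → InQℕ w p → InQℕ (2 + w) (shift p)
  shift-sound w {a , b} (a≤b , a+b≤w) =
    s≤s a≤b , s≤s (≤-trans (≤-reflexive (+-suc a b)) (s≤s a+b≤w))

  latticePoints-sound : ∀ w → All (InQℕ w) (latticePoints w)
  latticePoints-sound zero = column-sound 0
  latticePoints-sound (suc zero) = column-sound 1
  latticePoints-sound (suc (suc w)) =
    All.++⁺ (column-sound (2 + w)) (All.map⁺ (All.map (shift-sound w) (latticePoints-sound w)))

  column⊆latticePoints : ∀ w {p} → p ∈ column w → p ∈ latticePoints w
  column⊆latticePoints zero = λ p∈ → p∈
  column⊆latticePoints (suc zero) = λ p∈ → p∈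
  column⊆latticePoints (suc (suc w)) = ∈-++⁺ˡ

  latticePoints-complete : ∀ w {p} → InQℕ w p → p ∈ latticePoints w
  latticePoints-complete w {zero , b} (_ , b≤w) =
    column⊆latticePoints w (∈-map⁺ onAxis (∈-upTo⁺ (s≤s b≤w)))
  latticePoints-complete (suc (suc w)) {suc a , suc b} (s≤s a≤b , s≤s a+1+b≤1+w) =
    ∈-++⁺ʳ (column (2 + w)) (∈-map⁺ shift (latticePoints-complete w (a≤b , a+b≤w)))
    where
    a+b≤w : a + b ≤ w
    a+b≤w = ≤-pred (≤-trans (≤-reflexive (sym (+-suc a b))) a+1+b≤1+w)
  latticePoints-complete zero {suc a , b} (_ , ())
  latticePoints-complete (suc zero) {suc a , suc b} (_ , s≤s a+1+b≤0)
    = contradiction (m+n≤o⇒n≤o a a+1+b≤0) λ ()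
  latticePoints-complete (suc (suc w)) {suc a , zero} (() , _)
  latticePoints-complete (suc zero) {suc a , zero} (() , _)

  column-unique : ∀ n → Unique (column n)
  column-unique n = Unique.map⁺ (cong proj₂) (Unique.upTo⁺ (suc n))

  shift-injective : ∀ {p q} → shift p ≡ shift q → p ≡ q
  shift-injective {_ , _} {_ , _} refl = refl

  column-disjoint-shift : ∀ n ps {p} → ¬ (p ∈ column n × p ∈ map shift ps)
  column-disjoint-shift n ps (p∈column , p∈shifted)
    with ∈-map⁻ onAxis p∈column | ∈-map⁻ shift p∈shifted
  ... | _ , _ , refl | (_ , _) , _ , ()

  latticePoints-unique : ∀ w → Unique (latticePoints w)
  latticePoints-unique zero = column-unique 0
  latticePoints-unique (suc zero) = column-unique 1
  latticePoints-unique (suc (suc w)) =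
    Unique.++⁺ (column-unique (2 + w)) (Unique.map⁺ shift-injective (latticePoints-unique w))
               (column-disjoint-shift (2 + w) (latticePoints w))

  length-latticePoints-+2 : ∀ w →
    length (latticePoints (2 + w)) ≡ 3 + w + length (latticePoints w)
  length-latticePoints-+2 w = begin
    length (column (2 + w) ++ map shift (latticePoints w))
      ≡⟨ length-++ (column (2 + w)) {map shift (latticePoints w)} ⟩
    length (column (2 + w)) + length (map shift (latticePoints w))
      ≡⟨ cong₂ _+_ (trans (length-map onAxis (upTo (3 + w))) (length-upTo (3 + w)))
                   (length-map shift (latticePoints w)) ⟩
    3 + w + length (latticePoints w) ∎
    where open ≡-Reasoning

  CountFormula : ℕ → ℕ → Set
  CountFormula w n =
    (2 ∣ w → 4 * n ≡ w * w + 4 * w + 4) × (¬ (2 ∣ w) → 4 * n ≡ w * w + 4 * w + 3)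

  latticePoints-count : ∀ w → CountFormula w (length (latticePoints w))
  latticePoints-count zero = (λ _ → refl) , (λ 2∤0 → contradiction (divides 0 refl) 2∤0)
  latticePoints-count (suc zero) = (λ 2∣1 → contradiction 2∣1 2∤1) , (λ _ → refl)
    where
    2∤1 : ¬ (2 ∣ 1)
    2∤1 (divides zero ())
    2∤1 (divides (suc _) ())
  latticePoints-count (suc (suc w)) with even , odd ← latticePoints-count w =
      (λ 2∣2+w → step 4 (even (∣m+n∣m⇒∣n 2∣2+w n∣n)))
    , (λ 2∤2+w → step 3 (odd (λ 2∣w → 2∤2+w (∣m∣n⇒∣m+n n∣n 2∣w))))
    where
    n = length (latticePoints w)
    recurrence : ∀ w k →
      4 * (3 + w) + (w * w + 4 * w + k) ≡ (2 + w) * (2 + w) + 4 * (2 + w) + k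
    recurrence = solve-∀
    step : ∀ k → 4 * n ≡ w * w + 4 * w + k →
           4 * length (latticePoints (2 + w)) ≡ (2 + w) * (2 + w) + 4 * (2 + w) + k
    step k 4n≡ = begin
      4 * length (latticePoints (2 + w)) ≡⟨ cong (4 *_) (length-latticePoints-+2 w) ⟩
      4 * (3 + w + n)                    ≡⟨ *-distribˡ-+ 4 (3 + w) n ⟩
      4 * (3 + w) + 4 * n                ≡⟨ cong (4 * (3 + w) +_) 4n≡ ⟩
      4 * (3 + w) + (w * w + 4 * w + k)  ≡⟨ recurrence w k ⟩
      (2 + w) * (2 + w) + 4 * (2 + w) + k ∎
      where open ≡-Reasoning

open import Defs
open import Data.Nat using (ℕ; _*_; _+_)
open import Data.Nat.Divisibility using (_∣_)
open import Data.Integer using (ℤ; +_)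
open import Data.List using (List; length)
open import Data.List.Relation.Unary.All using (All)
open import Data.List.Relation.Unary.Any using (Any)
open import Data.List.Relation.Unary.AllPairs using (AllPairs)
open import Data.Product using (Σ; _×_; _,_)
open import Relation.Nullary using (¬_)
open import Relation.Binary.PropositionalEquality using (_≡_)

open import Data.Nat using (z≤n)
open import Data.Integer using (+≤+; -[1+_])
open import Data.Integer.Properties using (+-injective)
open import Data.List using (map)
open import Data.List.Properties using (length-map)
open import Data.List.Relation.Unary.All as All using ([]; _∷_)
import Data.List.Relation.Unary.All.Properties as All
import Data.List.Relation.Unary.Any as Any
import Data.List.Relation.Unary.Any.Properties as Any
open import Data.List.Relation.Unary.AllPairs using ([]; _∷_)
import Data.List.Relation.Unary.AllPairs.Properties as AllPairs
open import Relation.Binary.PropositionalEquality using (_≢_; refl; cong₂; subst; sym)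
open LatticePoints
open FourPointSets

AllPairs-map-All : ∀ {A : Set} {P : A → Set} {R S : A → A → Set} →
  (∀ {x y} → P x → P y → R x y → S x y) → ∀ {xs} → All P xs → AllPairs R xs → AllPairs S xs
AllPairs-map-All f [] [] = []
AllPairs-map-All f (px ∷ pxs) (Rx ∷ Rxs) =
  All.zipWith (λ (py , Rxy) → f px py Rxy) (pxs , Rx) ∷ AllPairs-map-All f pxs Rxs

toFourSet : ℕ → Point → FourSet
toFourSet w (a , b) = φ w (+ a) (+ b)

InQℕ⇒InQ : ∀ {w a b} → InQℕ w (a , b) → InQ w (+ a) (+ b)
InQℕ⇒InQ (a≤b , a+b≤w) = +≤+ z≤n , +≤+ a≤b , +≤+ a+b≤w

width-toFourSet : ∀ w {p} → InQℕ w p → width (toFourSet w p) ≡ + w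
width-toFourSet w {_ , _} q = width-φ (InQℕ⇒InQ q)

toFourSet-inequivalent : ∀ w {p q} → InQℕ w p → InQℕ w q → p ≢ q →
                         ¬ Equiv (toFourSet w p) (toFourSet w q)
toFourSet-inequivalent w {_ , _} {_ , _} inp inq p≢q p≃q
  with a≡c , b≡d ← φ-injective (InQℕ⇒InQ inp) (InQℕ⇒InQ inq) p≃q
  = p≢q (cong₂ _,_ (+-injective a≡c) (+-injective b≡d))

toFourSet-complete : ∀ w S → width S ≡ + w →
                     Any (Equiv S) (map (toFourSet w) (latticePoints w))
toFourSet-complete w S width≡w with φ-surjective S width≡w
... | + a , + b , (_ , +≤+ a≤b , +≤+ a+b≤w) , S≃φ =
  Any.map⁺ (Any.map (λ { refl → S≃φ }) (latticePoints-complete w (a≤b , a+b≤w)))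
... | + _ , -[1+ _ ] , (_ , () , _) , _
... | -[1+ _ ] , _ , (() , _ , _) , _

proposition3p1 : (w : ℕ) →
    ((x₁ x₂ : ℤ) → InQ w x₁ x₂ → width (φ w x₁ x₂) ≡ + w)
    × ((x₁ x₂ y₁ y₂ : ℤ) → InQ w x₁ x₂ → InQ w y₁ y₂ →
        Equiv (φ w x₁ x₂) (φ w y₁ y₂) → (x₁ ≡ y₁) × (x₂ ≡ y₂))
    × ((S : FourSet) → width S ≡ + w →
        Σ ℤ λ x₁ → Σ ℤ λ x₂ → InQ w x₁ x₂ × Equiv S (φ w x₁ x₂))
    × (Σ (List FourSet) λ L →
        All (λ S → width S ≡ + w) L
        × AllPairs (λ S T → ¬ Equiv S T) L
        × ((S : FourSet) → width S ≡ + w → Any (Equiv S) L)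
        × ((2 ∣ w → 4 * length L ≡ w * w + 4 * w + 4)
          × (¬ (2 ∣ w) → 4 * length L ≡ w * w + 4 * w + 3)))
proposition3p1 w =
    (λ _ _ → width-φ)
  , (λ _ _ _ _ → φ-injective)
  , φ-surjective
  , ( map (toFourSet w) (latticePoints w)
    , All.map⁺ (All.map (width-toFourSet w) (latticePoints-sound w))
    , AllPairs.map⁺ (AllPairs-map-All (toFourSet-inequivalent w)
                                      (latticePoints-sound w) (latticePoints-unique w))
    , toFourSet-complete w
    , subst (CountFormula w) (sym (length-map (toFourSet w) (latticePoints w)))
            (latticePoints-count w) )
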